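{- Let $G$ be a bipartite graph with left class $V$ and right class $W$ such that $M_T(G)$ is a finitary matroid, and let $K$ be a subset of $\{vw\notin E(G): v\in V, w\in W\}$. Then the following are equivalent: (1) $M_T(G)\neq M_T(G+K)$; (2) there are $vw\in K$ and a circuit $C$ of $M_T(G)$ with $v\in C$ and $w\notin N_G(C)$; (3) there is $vw\in K$ such that $v$ is not a coloop of $M_T(G)\setminus N_G(w)$.
   Context: $M_T(G)$ is the pair of $V$ and the subsets $I\subseteq V$ admitting a matching of $G$ with set of left endpoints exactly $I$. $G+K$ is $G$ with the edges of $K$ added. $N_G(X)$ is the neighbourhood in $G$; $M_T(G)\setminus N_G(w)$ is the deletion of the set $N_G(w)\subseteq V$. A matroid is finitary if a set is independent whenever all its finite subsets are; a coloop is an element contained in every base. -}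

module Defs where

open import Level using (0ℓ)
open import Data.Product using (Σ; ∃; _×_; _,_)
open import Data.List using (List)
open import Data.Sum using (_⊎_)
open import Data.List.Membership.Propositional using () renaming (_∈_ to _∈ₗ_)
open import Relation.Nullary using (¬_)
open import Relation.Unary using (Pred; _∈_; _∉_; _⊆_; ∅; U; ∁; _∪_; ｛_｝)
open import Relation.Binary.PropositionalEquality using (_≡_)

-- A bipartite graph is given by a left class V, a right class W
-- (arbitrary, possibly infinite types) and an edge relation E : V → W → Set.

record Matching {V W : Set} (E : V → W → Set) : Set₁ where
  field
    edge      : V → W → Set
    inE       : ∀ {v w} → edge v w → E v w
    uniqueˡ   : ∀ {v w w'} → edge v w → edge v w' → w ≡ w'
    uniqueʳ   : ∀ {v v' w} → edge v w → edge v' w → v ≡ v'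

leftEnds : {V W : Set} {E : V → W → Set} → Matching E → Pred V 0ℓ
leftEnds M v = ∃ λ w → Matching.edge M v w

MT : {V W : Set} → (V → W → Set) → Pred V 0ℓ → Set₁
MT E I = Σ (Matching E) λ M → (I ⊆ leftEnds M) × (leftEnds M ⊆ I)

_+E_ : {V W : Set} → (V → W → Set) → (V → W → Set) → (V → W → Set)
(E +E K) v w = E v w ⊎ K v w

N : {V W : Set} → (V → W → Set) → Pred V 0ℓ → Pred W 0ℓ
N E X w = ∃ λ v → v ∈ X × E v w

Nw : {V W : Set} → (V → W → Set) → W → Pred V 0ℓ
Nw E w v = E v w

module _ {V : Set} (Ind : Pred V 0ℓ → Set₁) where

  MaximalIn : Pred V 0ℓ → Pred V 0ℓ → Set₁
  MaximalIn X B = Ind B × B ⊆ X × (∀ J → Ind J → B ⊆ J → J ⊆ X → J ⊆ B)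

  -- Matroid axioms (I1),(I2),(I3),(IM) of Bruhn–Diestel–Kriesell–Pendavingh–Wollan,
  -- with ground set the whole of V.
  IsMatroid : Set₁
  IsMatroid =
    Ind ∅ ×
    (∀ I J → Ind I → J ⊆ I → Ind J) ×
    (∀ I I' → Ind I → ¬ MaximalIn U I → MaximalIn U I' →
       ∃ λ x → x ∈ I' × x ∉ I × Ind (I ∪ ｛ x ｝)) ×
    (∀ I X → Ind I → I ⊆ X → ∃ λ B → I ⊆ B × MaximalIn X B)

  Finitary : Set₁
  Finitary = ∀ I →
    (∀ (xs : List V) → (∀ x → x ∈ₗ xs → x ∈ I) → Ind (λ x → x ∈ₗ xs)) → Ind I

  Circuit : Pred V 0ℓ → Set₁
  Circuit C = ¬ Ind C × (∀ D → D ⊆ C → (∃ λ x → x ∈ C × x ∉ D) → Ind D)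

SameMatroid : {V : Set} → (Pred V 0ℓ → Set₁) → (Pred V 0ℓ → Set₁) → Set₁
SameMatroid Ind Ind' = ∀ I → (Ind I → Ind' I) × (Ind' I → Ind I)

-- Matroid on ground set V with independence Ind, deletion of X ⊆ V:
-- ground set ∁ X, independent sets the independent sets contained in ∁ X.
-- e is a coloop of M \ X iff e ∈ ∁ X and e lies in every base of M \ X
-- (bases = maximal independent subsets of the ground set ∁ X).
IsColoopOfDeletion : {V : Set} → (Pred V 0ℓ → Set₁) → Pred V 0ℓ → V → Set₁
IsColoopOfDeletion Ind X e =
  e ∈ ∁ X × (∀ B → MaximalIn (λ I → Ind I × I ⊆ ∁ X) (∁ X) B → e ∈ B)

-- (1)⇒(2): an independent set of G+K that is dependent in G contains, by finitarity, a finite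
-- circuit C of M_T(G). Fix v ∈ C and a matching M of C − v. Alternating paths from v show that M
-- covers N_G(C): a free neighbour of a vertex reachable from v would let us switch M along the
-- path and match all of C, and otherwise the reachable set is injected by "matching edge, then
-- M-edge back" into itself minus v, so it is dependent and hence is all of C. The same injection
-- argument shows that a matching of C in G+K must leave N_G(C) along some K-edge.
-- (2)⇒(3): a base of M_T(G) \ N_G(w) extending C − v cannot contain C, so it misses v.
-- (3)⇒(1): if a base B of M_T(G) \ N_G(w) misses v, then B + v is matchable in G+K via vw,
-- but not in G by maximality of B.
module Submission where

open import Defs
open import Level using (0ℓ)
open import Axiom.ExcludedMiddle using (ExcludedMiddle)
open import Axiom.DoubleNegationElimination using (em⇒dne)
open import Data.Empty using (⊥; ⊥-elim)
open import Data.Product using (Σ; ∃; ∃₂; _×_; _,_; proj₁; proj₂)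
open import Data.Sum using (_⊎_; inj₁; inj₂)
open import Data.Nat using (ℕ; zero; suc; _<_; s≤s)
open import Data.Nat.Properties using (<⇒≢; n<1+n; <-≤-trans)
open import Data.Fin using (Fin; toℕ)
open import Data.Fin.Properties using (pigeonhole)
open import Data.List using (List; length; filter; lookup)
open import Data.List.Properties using (filter-notAll)
open import Data.List.Relation.Unary.Any using (index) renaming (map to any-map)
open import Data.List.Relation.Unary.Any.Properties using (lookup-index)
open import Data.List.Membership.Propositional using () renaming (_∈_ to _∈ₗ_)
open import Data.List.Membership.Propositional.Properties using (∈-filter⁺; ∈-filter⁻)
open import Function using (_∘_; _on_; id)
open import Function.Definitions using (Injective)
open import Relation.Nullary using (¬_; yes; no)
open import Relation.Nullary.Decidable using (¬?)
open import Relation.Unary using (Pred; _∈_; _∉_; _⊆_; _≐_; ∁; ∅; _∪_; _∖_; ｛_｝)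
open import Relation.Binary.PropositionalEquality using (_≡_; refl; sym; subst; cong)
open Relation.Binary.PropositionalEquality.≡-Reasoning

open Matching

module _ {V W : Set} {E : V → W → Set} where

  rightEnds : Matching E → Pred W 0ℓ
  rightEnds M y = ∃ λ x → edge M x y

  restrict : Pred V 0ℓ → Matching E → Matching E
  restrict J M = record
    { edge    = λ x y → x ∈ J × edge M x y
    ; inE     = λ (_ , e) → inE M e
    ; uniqueˡ = λ (_ , e) (_ , e') → uniqueˡ M e e'
    ; uniqueʳ = λ (_ , e) (_ , e') → uniqueʳ M e e'
    }

  addEdge : (M : Matching E) (x : V) (y : W) →
            x ∉ leftEnds M → y ∉ rightEnds M → E x y → Matching E
  addEdge M x y x-free y-free exy = record
    { edge    = λ x' y' → edge M x' y' ⊎ (x ≡ x' × y ≡ y')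
    ; inE     = λ { (inj₁ e) → inE M e ; (inj₂ (refl , refl)) → exy }
    ; uniqueˡ = uniqueˡ'
    ; uniqueʳ = uniqueʳ'
    }
    where
    uniqueˡ' : ∀ {x' y₁ y₂} → edge M x' y₁ ⊎ (x ≡ x' × y ≡ y₁) →
               edge M x' y₂ ⊎ (x ≡ x' × y ≡ y₂) → y₁ ≡ y₂
    uniqueˡ' (inj₁ e)             (inj₁ e')            = uniqueˡ M e e'
    uniqueˡ' (inj₁ e)             (inj₂ (refl , _))    = ⊥-elim (x-free (_ , e))
    uniqueˡ' (inj₂ (refl , _))    (inj₁ e')            = ⊥-elim (x-free (_ , e'))
    uniqueˡ' (inj₂ (_ , refl))    (inj₂ (_ , refl))    = refl

    uniqueʳ' : ∀ {x₁ x₂ y'} → edge M x₁ y' ⊎ (x ≡ x₁ × y ≡ y') →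
               edge M x₂ y' ⊎ (x ≡ x₂ × y ≡ y') → x₁ ≡ x₂
    uniqueʳ' (inj₁ e)             (inj₁ e')            = uniqueʳ M e e'
    uniqueʳ' (inj₁ e)             (inj₂ (_ , refl))    = ⊥-elim (y-free (_ , e))
    uniqueʳ' (inj₂ (_ , refl))    (inj₁ e')            = ⊥-elim (y-free (_ , e'))
    uniqueʳ' (inj₂ (refl , _))    (inj₂ (refl , _))    = refl

  MT-⊆ : ∀ {I J} → MT E I → J ⊆ I → MT E J
  MT-⊆ {J = J} (M , I⊆M , M⊆I) J⊆I =
    restrict J M , (λ x∈J → proj₁ (I⊆M (J⊆I x∈J)) , x∈J , proj₂ (I⊆M (J⊆I x∈J))) ,
                   (λ (_ , x∈J , _) → x∈J)

liftMatching : {V W : Set} {E E' : V → W → Set} → (∀ {x y} → E x y → E' x y) →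
               Matching E → Matching E'
liftMatching E⊆E' M =
  record { edge = edge M ; inE = E⊆E' ∘ inE M ; uniqueˡ = uniqueˡ M ; uniqueʳ = uniqueʳ M }

MT-mono : {V W : Set} {E E' : V → W → Set} → (∀ {x y} → E x y → E' x y) →
          ∀ {I} → MT E I → MT E' I
MT-mono E⊆E' (M , ends) = liftMatching E⊆E' M , ends

MT-insert : {V W : Set} {E K : V → W → Set} {I : Pred V 0ℓ} {x : V} {y : W} →
  MT E I → x ∉ I → (∀ {x'} → x' ∈ I → ¬ E x' y) → K x y → MT (E +E K) (I ∪ ｛ x ｝)
MT-insert {x = x} {y} (M , I⊆M , M⊆I) x∉I y∉N[I] kxy =
  addEdge (liftMatching inj₁ M) x y (x∉I ∘ M⊆I) (λ (_ , m) → y∉N[I] (M⊆I (_ , m)) (inE M m))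
          (inj₂ kxy) ,
  (λ { (inj₁ x'∈I) → let z , m = I⊆M x'∈I in z , inj₁ m
     ; (inj₂ refl)  → y , inj₂ (refl , refl) }) ,
  (λ { (_ , inj₁ m)             → inj₁ (M⊆I (_ , m))
     ; (_ , inj₂ (refl , refl)) → inj₂ refl })

module _ {V : Set} where

  injective-sequence-leaves-list : (xs : List V) (g : ℕ → V) →
    (∀ {i j} → g i ≡ g j → i ≡ j) → ¬ (∀ n → g n ∈ₗ xs)
  injective-sequence-leaves-list xs g g-injective g∈xs =
    let i , j , i<j , same-position = pigeonhole (n<1+n (length xs)) position
    in <⇒≢ i<j (g-injective (begin
         g (toℕ i)              ≡⟨ lookup-index (g∈xs (toℕ i)) ⟩
         lookup xs (position i) ≡⟨ cong (lookup xs) same-position ⟩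
         lookup xs (position j) ≡⟨ lookup-index (g∈xs (toℕ j)) ⟨
         g (toℕ j)              ∎))
    where
    position : Fin (suc (length xs)) → Fin (length xs)
    position k = index (g∈xs (toℕ k))

  no-injection-into-proper-subset : (xs : List V) {S : Pred V 0ℓ} → S ⊆ (_∈ₗ xs) →
    {v : V} → v ∈ S → (f : Σ V S → Σ V S) → Injective (_≡_ on proj₁) (_≡_ on proj₁) f →
    (∀ a → proj₁ (f a) ∉ ｛ v ｝) → ⊥
  no-injection-into-proper-subset xs {S} S⊆xs {v} v∈S f f-injective f-misses-v =
    injective-sequence-leaves-list xs (proj₁ ∘ orbit) orbit-injective (S⊆xs ∘ proj₂ ∘ orbit)
    where
    orbit : ℕ → Σ V S
    orbit zero    = v , v∈S
    orbit (suc n) = f (orbit n)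

    orbit-injective : ∀ {i j} → proj₁ (orbit i) ≡ proj₁ (orbit j) → i ≡ j
    orbit-injective {zero}  {zero}  _  = refl
    orbit-injective {zero}  {suc j} eq = ⊥-elim (f-misses-v (orbit j) eq)
    orbit-injective {suc i} {zero}  eq = ⊥-elim (f-misses-v (orbit i) (sym eq))
    orbit-injective {suc i} {suc j} eq = cong suc (orbit-injective (f-injective eq))

-- Following the Q-edge of x ∈ S and then the M-edge back is an injection S → S ∖ {v}.
matching-pigeonhole : {V W : Set} {A B : V → W → Set} (xs : List V) {S : Pred V 0ℓ} →
  S ⊆ (_∈ₗ xs) → {v : V} → v ∈ S → (Q : Matching A) (M : Matching B) →
  (∀ {x} → x ∈ S → ∃ λ y → edge Q x y × ∃ λ x' → x' ∈ S ∖ ｛ v ｝ × edge M x' y) → ⊥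
matching-pigeonhole {V} xs {S} S⊆xs {v} v∈S Q M route =
  no-injection-into-proper-subset xs S⊆xs v∈S back-along-M back-injective back-misses-v
  where
  back-along-M : Σ V S → Σ V S
  back-along-M (_ , x∈S) = let (_ , _ , x' , (x'∈S , _) , _) = route x∈S in x' , x'∈S

  back-misses-v : ∀ a → proj₁ (back-along-M a) ∉ ｛ v ｝
  back-misses-v (_ , x∈S) = let (_ , _ , _ , (_ , x'≢v) , _) = route x∈S in x'≢v

  back-injective : Injective (_≡_ on proj₁) (_≡_ on proj₁) back-along-M
  back-injective {x , x∈S} {z , z∈S} same-x' =
    let (y , qxy , _ , _ , mx'y) = route x∈S
        (y' , qzy' , _ , _ , mz'y') = route z∈S
        y≡y' = uniqueˡ M mx'y (subst (λ x' → edge M x' y') (sym same-x') mz'y')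
    in uniqueʳ Q qxy (subst (edge Q z) (sym y≡y') qzy')

module Classical (em : ∀ {ℓ} → ExcludedMiddle ℓ) where

  dne : ∀ {ℓ} {P : Set ℓ} → ¬ ¬ P → P
  dne = em⇒dne em

  ¬∀⇒∃¬ : ∀ {a b} {A : Set a} {P : A → Set b} → ¬ (∀ x → P x) → ∃ λ x → ¬ P x
  ¬∀⇒∃¬ ¬∀ = dne λ ¬∃ → ¬∀ λ x → dne λ ¬Px → ¬∃ (x , ¬Px)

  ¬→⇒×¬ : ∀ {a b} {P : Set a} {Q : Set b} → ¬ (P → Q) → P × ¬ Q
  ¬→⇒×¬ ¬P→Q = dne (λ ¬P → ¬P→Q (⊥-elim ∘ ¬P)) , (λ q → ¬P→Q λ _ → q)

  module _ {V : Set} {Ind : Pred V 0ℓ → Set₁} where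

    circuit-minus-independent : ∀ {C v} → Circuit Ind C → v ∈ C → Ind (C ∖ ｛ v ｝)
    circuit-minus-independent (_ , proper-independent) v∈C =
      proper-independent _ proj₁ (_ , v∈C , λ (_ , v≢v) → v≢v refl)

    circuit-⊆-dependent : ∀ {C D} → Circuit Ind C → D ⊆ C → ¬ Ind D → C ⊆ D
    circuit-⊆-dependent (_ , proper-independent) D⊆C D-dependent x∈C =
      dne λ x∉D → D-dependent (proper-independent _ D⊆C (_ , x∈C , x∉D))

    circuit-nonempty : (∀ I J → Ind I → J ⊆ I → Ind J) → Ind ∅ →
                       ∀ {C} → Circuit Ind C → ∃ λ v → v ∈ C
    circuit-nonempty ind-⊆ ind-∅ (C-dependent , _) =
      dne λ C-empty → C-dependent (ind-⊆ ∅ _ ind-∅ λ x∈C → C-empty (_ , x∈C))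

    ¬circuit⇒dependent-proper-subset : ∀ {C} → ¬ Ind C → ¬ Circuit Ind C →
      ∃ λ D → D ⊆ C × (∃ λ x → x ∈ C × x ∉ D) × ¬ Ind D
    ¬circuit⇒dependent-proper-subset C-dependent ¬circuit =
      let D , ¬[D⊆C→proper→Ind] = ¬∀⇒∃¬ (λ minimal → ¬circuit (C-dependent , minimal))
          D⊆C , ¬[proper→Ind] = ¬→⇒×¬ ¬[D⊆C→proper→Ind]
          proper , D-dependent = ¬→⇒×¬ ¬[proper→Ind]
      in D , D⊆C , proper , D-dependent

    finite-dependent⇒circuit : (∀ I J → Ind I → J ⊆ I → Ind J) →
      (xs : List V) → ¬ Ind (_∈ₗ xs) → ∃ λ C → C ⊆ (_∈ₗ xs) × Circuit Ind C
    finite-dependent⇒circuit ind-⊆ xs = shrink (suc (length xs)) xs (n<1+n (length xs))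
      where
      shrink : ∀ n xs → length xs < n → ¬ Ind (_∈ₗ xs) → ∃ λ C → C ⊆ (_∈ₗ xs) × Circuit Ind C
      shrink (suc n) xs (s≤s |xs|≤n) xs-dependent with em {P = Circuit Ind (_∈ₗ xs)}
      ... | yes circuit = _ , id , circuit
      ... | no ¬circuit =
        let D , D⊆xs , (x , x∈xs , x∉D) , D-dependent =
              ¬circuit⇒dependent-proper-subset xs-dependent ¬circuit
            ≢x? = λ y → ¬? (em {P = x ≡ y})
            ys = filter ≢x? xs
            D⊆ys : D ⊆ (_∈ₗ ys)
            D⊆ys d∈D = ∈-filter⁺ ≢x? (D⊆xs d∈D) λ { refl → x∉D d∈D }
            C , C⊆ys , circuit = shrink n ys
              (<-≤-trans (filter-notAll ≢x? xs (any-map (λ x≡y x≢y → x≢y x≡y) x∈xs)) |xs|≤n)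
              (λ ys-independent → D-dependent (ind-⊆ _ D ys-independent D⊆ys))
        in C , proj₁ ∘ ∈-filter⁻ ≢x? ∘ C⊆ys , circuit

    finitary-separating-list : {Ind' : Pred V 0ℓ → Set₁} → Finitary Ind →
      (∀ {I} → Ind I → Ind' I) → (∀ {I J} → Ind' I → J ⊆ I → Ind' J) →
      ¬ SameMatroid Ind Ind' → ∃ λ xs → Ind' (_∈ₗ xs) × ¬ Ind (_∈ₗ xs)
    finitary-separating-list finitary Ind⊆Ind' ind'-⊆ distinct =
      let I , ¬[same-at-I] = ¬∀⇒∃¬ distinct
          I-ind' , I-dependent = ¬→⇒×¬ (λ back → ¬[same-at-I] (Ind⊆Ind' , back))
          xs , ¬[xs⊆I→ind] = ¬∀⇒∃¬ (λ finite-ind → I-dependent (finitary I finite-ind))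
          xs⊆I , xs-dependent = ¬→⇒×¬ ¬[xs⊆I→ind]
      in xs , ind'-⊆ I-ind' (xs⊆I _) , xs-dependent

    DeletionBase : Pred V 0ℓ → Pred V 0ℓ → Set₁
    DeletionBase X = MaximalIn (λ I → Ind I × I ⊆ ∁ X) (∁ X)

    circuit-element-not-coloop : (∀ I J → Ind I → J ⊆ I → Ind J) →
      (∀ I X → Ind I → I ⊆ X → ∃ λ B → I ⊆ B × MaximalIn Ind X B) →
      ∀ {C v X} → Circuit Ind C → v ∈ C → C ∖ ｛ v ｝ ⊆ ∁ X → ¬ IsColoopOfDeletion Ind X v
    circuit-element-not-coloop ind-⊆ extend {C} {v} {X} circuit v∈C C-v⊆∁X (_ , in-every-base)
      with extend _ (∁ X) (circuit-minus-independent circuit v∈C) C-v⊆∁X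
    ... | B , C-v⊆B , B-independent , B⊆∁X , maximal =
      proj₁ circuit (ind-⊆ B C B-independent C⊆B)
      where
      C⊆B : C ⊆ B
      C⊆B {x} x∈C with em {P = v ≡ x}
      ... | yes refl = in-every-base B ((B-independent , B⊆∁X) , B⊆∁X ,
                                         λ J (J-independent , _) → maximal J J-independent)
      ... | no  v≢x  = C-v⊆B (x∈C , v≢x)

    ¬coloop⇒avoiding-base : ∀ {X v} → v ∈ ∁ X → ¬ IsColoopOfDeletion Ind X v →
      ∃ λ B → DeletionBase X B × v ∉ B
    ¬coloop⇒avoiding-base v∉X ¬coloop =
      let B , ¬[base→v∈B] = ¬∀⇒∃¬ (λ in-every-base → ¬coloop (v∉X , in-every-base))
      in B , ¬→⇒×¬ ¬[base→v∈B]

  module AlternatingPaths {V W : Set} {E : V → W → Set}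
    {C : Pred V 0ℓ} (C-circuit : Circuit (MT E) C)
    {v : V} (v∈C : v ∈ C) (M : Matching E) (M-ends : C ∖ ｛ v ｝ ≐ leftEnds M) where

    Reachable : ℕ → Pred V 0ℓ
    Reachable zero    = ｛ v ｝
    Reachable (suc n) = Reachable n ∪ λ x → ∃₂ λ u y → u ∈ Reachable n × E u y × edge M x y

    reachable⊆C : ∀ n → Reachable n ⊆ C
    reachable⊆C zero    refl                           = v∈C
    reachable⊆C (suc n) (inj₁ r)                       = reachable⊆C n r
    reachable⊆C (suc n) (inj₂ (_ , _ , _ , _ , m)) = proj₁ (proj₂ M-ends (_ , m))

    -- The matching obtained from M by switching along an alternating path from v to u.
    record Switched (n : ℕ) (u : V) : Set₁ where
      field
        matching : Matching E
        ends     : C ∖ ｛ u ｝ ≐ leftEnds matching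
        within   : rightEnds matching ⊆ rightEnds M
        agrees   : ∀ {x y} → x ∉ Reachable n → edge M x y → edge matching x y

    weaken : ∀ {n u} → Switched n u → Switched (suc n) u
    weaken s = record { matching = matching ; ends = ends ; within = within
                      ; agrees = λ x∉R → agrees (x∉R ∘ inj₁) }
      where open Switched s

    switch : ∀ n {u} → u ∈ Reachable n → Switched n u
    switch zero refl = record { matching = M ; ends = M-ends ; within = id ; agrees = λ _ m → m }
    switch (suc n) (inj₁ r) = weaken (switch n r)
    switch (suc n) {u} (inj₂ (u₀ , y , r₀ , e , muy)) with em {P = u ∈ Reachable n}
    ... | yes r = weaken (switch n r)
    ... | no u∉R =
      record { matching = N₁ ; ends = ends⁺ , ends⁻ ; within = within' ; agrees = agrees' }
      where
      open Switched (switch n r₀) renaming (matching to N₀)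

      N₀uy : edge N₀ u y
      N₀uy = agrees u∉R muy

      N₀-u : Matching E
      N₀-u = restrict (∁ ｛ u ｝) N₀

      N₁ : Matching E
      N₁ = addEdge N₀-u u₀ y
            (λ (_ , _ , N₀u₀) → proj₂ (proj₂ ends (_ , N₀u₀)) refl)
            (λ (_ , u≢x , N₀xy) → u≢x (uniqueʳ N₀ N₀uy N₀xy))
            e

      ends⁺ : C ∖ ｛ u ｝ ⊆ leftEnds N₁
      ends⁺ {x} (x∈C , u≢x) with em {P = u₀ ≡ x}
      ... | yes u₀≡x = y , inj₂ (u₀≡x , refl)
      ... | no  u₀≢x = let z , N₀xz = proj₁ ends (x∈C , u₀≢x) in z , inj₁ (u≢x , N₀xz)

      ends⁻ : leftEnds N₁ ⊆ C ∖ ｛ u ｝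
      ends⁻ (_ , inj₁ (u≢x , N₀xz))  = proj₁ (proj₂ ends (_ , N₀xz)) , u≢x
      ends⁻ (_ , inj₂ (refl , refl)) = reachable⊆C n r₀ , λ { refl → u∉R r₀ }

      within' : rightEnds N₁ ⊆ rightEnds M
      within' (_ , inj₁ (_ , N₀xz))   = within (_ , N₀xz)
      within' (_ , inj₂ (_ , refl))   = u , muy

      agrees' : ∀ {x z} → x ∉ Reachable (suc n) → edge M x z → edge N₁ x z
      agrees' x∉R mxz = inj₁ ((λ { refl → x∉R (inj₂ (u₀ , y , r₀ , e , muy)) }) ,
                              agrees (x∉R ∘ inj₁) mxz)

    -- A free neighbour of a reachable u would augment the switched matching to one covering C.
    reachable-neighbour-covered : ∀ n {u y} → u ∈ Reachable n → E u y → y ∈ rightEnds M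
    reachable-neighbour-covered n {u} {y} r euy = dne y-free⇒C-independent
      where
      open Switched (switch n r)

      y-free⇒C-independent : y ∉ rightEnds M → ⊥
      y-free⇒C-independent y-free = proj₁ C-circuit (augmented , C⊆ , ⊆C)
        where
        augmented : Matching E
        augmented = addEdge matching u y (λ (_ , Nuz) → proj₂ (proj₂ ends (_ , Nuz)) refl)
                                         (y-free ∘ within) euy

        C⊆ : C ⊆ leftEnds augmented
        C⊆ {x} x∈C with em {P = u ≡ x}
        ... | yes u≡x = y , inj₂ (u≡x , refl)
        ... | no  u≢x = let z , Nxz = proj₁ ends (x∈C , u≢x) in z , inj₁ Nxz

        ⊆C : leftEnds augmented ⊆ C
        ⊆C (_ , inj₁ Nxz)          = proj₁ (proj₂ ends (_ , Nxz))
        ⊆C (_ , inj₂ (refl , refl)) = reachable⊆C n r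

    Reached : Pred V 0ℓ
    Reached x = ∃ λ n → x ∈ Reachable n

    reached⊆C : Reached ⊆ C
    reached⊆C (n , r) = reachable⊆C n r

    reached-dependent : (xs : List V) → C ⊆ (_∈ₗ xs) → ¬ MT E Reached
    reached-dependent xs C⊆xs (Q , Q-ends , _) =
      matching-pigeonhole xs (C⊆xs ∘ reached⊆C) (0 , refl) Q M route
      where
      route : ∀ {x} → x ∈ Reached →
              ∃ λ y → edge Q x y × ∃ λ x' → x' ∈ Reached ∖ ｛ v ｝ × edge M x' y
      route (n , r) =
        let y , qxy = Q-ends (n , r)
            x' , mx'y = reachable-neighbour-covered n r (inE Q qxy)
            x'-reached = suc n , inj₂ (_ , y , r , inE Q qxy , mx'y)
        in y , qxy , x' , (x'-reached , proj₂ (proj₂ M-ends (y , mx'y))) , mx'y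

    circuit-neighbours-covered : (xs : List V) → C ⊆ (_∈ₗ xs) → N E C ⊆ rightEnds M
    circuit-neighbours-covered xs C⊆xs (u , u∈C , euy) =
      let n , r = circuit-⊆-dependent C-circuit reached⊆C (reached-dependent xs C⊆xs) u∈C
      in reachable-neighbour-covered n r euy

  module _ {V W : Set} {E K : V → W → Set} where

    EscapingKEdge : Pred V 0ℓ → Set
    EscapingKEdge C = ∃ λ x → ∃ λ w → K x w × x ∈ C × w ∉ N E C

    -- Every vertex of C has its G+K partner in N_G(C) unless some K-edge escapes; those partners
    -- are matched into C ∖ {v} by M, which is impossible for the finite set C.
    circuit-independent-in-G+K⇒escaping-K-edge : (xs : List V) {C : Pred V 0ℓ} → C ⊆ (_∈ₗ xs) →
      Circuit (MT E) C → ∀ {v} → v ∈ C → MT (E +E K) C → EscapingKEdge C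
    circuit-independent-in-G+K⇒escaping-K-edge xs {C} C⊆xs circuit {v} v∈C (Q , Q-ends , _)
      with circuit-minus-independent circuit v∈C
    ... | M , M-ends = dne λ no-escape → matching-pigeonhole xs C⊆xs v∈C Q M (route no-escape)
      where
      open AlternatingPaths circuit v∈C M M-ends using (circuit-neighbours-covered)

      partner-in-N : ¬ EscapingKEdge C →
                     ∀ {x y} → x ∈ C → edge Q x y → y ∈ N E C
      partner-in-N no-escape {x} {y} x∈C qxy with inE Q qxy
      ... | inj₁ exy = x , x∈C , exy
      ... | inj₂ kxy = dne λ y∉N → no-escape (x , y , kxy , x∈C , y∉N)

      route : ¬ EscapingKEdge C →
              ∀ {x} → x ∈ C → ∃ λ y → edge Q x y × ∃ λ x' → x' ∈ C ∖ ｛ v ｝ × edge M x' y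
      route no-escape x∈C =
        let y , qxy = Q-ends x∈C
            x' , mx'y = circuit-neighbours-covered xs C⊆xs (partner-in-N no-escape x∈C qxy)
        in y , qxy , x' , proj₂ M-ends (y , mx'y) , mx'y

lemma3p16 : (em : ∀ {ℓ} → ExcludedMiddle ℓ) →
    {V W : Set} (E : V → W → Set) →
    IsMatroid (MT E) → Finitary (MT E) →
    (K : V → W → Set) → (∀ {v w} → K v w → ¬ E v w) →
    let c1 = ¬ SameMatroid (MT E) (MT (E +E K))
        c2 = ∃ λ v → ∃ λ w → K v w × ∃ λ C → Circuit (MT E) C × v ∈ C × w ∉ N E C
        c3 = ∃ λ v → ∃ λ w → K v w × ¬ IsColoopOfDeletion (MT E) (Nw E w) v
    in (c1 → c2) × (c2 → c3) × (c3 → c1)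
lemma3p16 em E (ind-∅ , ind-⊆ , _ , extend) finitary K K∉E = c1→c2 , c2→c3 , c3→c1
  where
  open Classical em

  Distinct EscapingCircuit NotColoop : Set₁
  Distinct = ¬ SameMatroid (MT E) (MT (E +E K))
  EscapingCircuit = ∃ λ v → ∃ λ w → K v w × ∃ λ C → Circuit (MT E) C × v ∈ C × w ∉ N E C
  NotColoop = ∃ λ v → ∃ λ w → K v w × ¬ IsColoopOfDeletion (MT E) (Nw E w) v

  c1→c2 : Distinct → EscapingCircuit
  c1→c2 distinct =
    let xs , xs-ind⁺ , xs-dependent =
          finitary-separating-list finitary (MT-mono inj₁) MT-⊆ distinct
        C , C⊆xs , circuit = finite-dependent⇒circuit ind-⊆ xs xs-dependent
        v , v∈C = circuit-nonempty ind-⊆ ind-∅ circuit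
        x , w , kxw , x∈C , w∉N[C] =
          circuit-independent-in-G+K⇒escaping-K-edge xs C⊆xs circuit v∈C (MT-⊆ xs-ind⁺ C⊆xs)
    in x , w , kxw , C , circuit , x∈C , w∉N[C]

  c2→c3 : EscapingCircuit → NotColoop
  c2→c3 (v , w , kvw , C , circuit , v∈C , w∉N[C]) =
    v , w , kvw ,
    circuit-element-not-coloop ind-⊆ extend circuit v∈C λ (x∈C , _) exw → w∉N[C] (_ , x∈C , exw)

  c3→c1 : NotColoop → Distinct
  c3→c1 (v , w , kvw , ¬coloop) same =
    let B , ((B-ind , B⊆∁N[w]) , _ , maximal) , v∉B = ¬coloop⇒avoiding-base (K∉E kvw) ¬coloop
        B+v⊆∁N[w] : B ∪ ｛ v ｝ ⊆ ∁ (Nw E w)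
        B+v⊆∁N[w] = λ { (inj₁ x∈B) → B⊆∁N[w] x∈B ; (inj₂ refl) → K∉E kvw }
        B+v-ind = proj₂ (same _) (MT-insert B-ind v∉B B⊆∁N[w] kvw)
    in v∉B (maximal _ (B+v-ind , B+v⊆∁N[w]) inj₁ B+v⊆∁N[w] (inj₂ refl))
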